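{- Let $N\ge2$, let $\mathbf{w}\in\mathbb{Z}^N$ be nonzero and $\mathbf{w}^\perp=\{\mathbf{v}\in\mathbb{R}^N:\mathbf{v}\cdot\mathbf{w}=0\}$. There exists an $N\times(N-1)$ integral matrix $H$ whose image is $\mathbf{w}^\perp$ and $\|H\|_\infty=\|\mathbf{w}\|_\infty$.
   Context: $\|H\|_\infty$ is the maximum absolute value of the entries of $H$; $\|\mathbf{w}\|_\infty$ the sup norm.
   Formalization: The image of H and $\mathbf{w}^\perp$ are taken over ℚ, comparing only rational vectors with rational preimages, instead of vectors in ℝ^N. -}

module Defs where

open import Data.Nat using (ℕ; zero; suc; _⊔_)
open import Data.Fin using (Fin; zero; suc)
open import Data.Integer as ℤ using (ℤ; ∣_∣)
open import Data.Rational as ℚ using (ℚ; 0ℚ; _/_)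

maxFin : (n : ℕ) → (Fin n → ℕ) → ℕ
maxFin zero    f = 0
maxFin (suc n) f = f zero ⊔ maxFin n (λ i → f (suc i))

sumℚ : (n : ℕ) → (Fin n → ℚ) → ℚ
sumℚ zero    f = 0ℚ
sumℚ (suc n) f = f zero ℚ.+ sumℚ n (λ i → f (suc i))

toℚ : ℤ → ℚ
toℚ z = z / 1

supNormVec : (n : ℕ) → (Fin n → ℤ) → ℕ
supNormVec n w = maxFin n (λ i → ∣ w i ∣)

supNormMat : (m k : ℕ) → (Fin m → Fin k → ℤ) → ℕ
supNormMat m k H = maxFin m (λ i → maxFin k (λ j → ∣ H i j ∣))

dotℚ : (n : ℕ) → (Fin n → ℚ) → (Fin n → ℤ) → ℚ
dotℚ n v w = sumℚ n (λ i → v i ℚ.* toℚ (w i))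

matVecℚ : (m k : ℕ) → (Fin m → Fin k → ℤ) → (Fin k → ℚ) → Fin m → ℚ
matVecℚ m k H u i = sumℚ k (λ j → toℚ (H i j) ℚ.* u j)

-- Choose a pivot k with |w k| maximal; then w k ≠ 0. The N − 1 integer vectors
-- (w k) e_j − (w j) e_k, j ≠ k, are orthogonal to w, and they span w⊥ because a
-- vector v ∈ w⊥ is determined by its coordinates off k, so v = Σ_{j≠k} (v j / w k) · column j.
-- Their entries are w k, − w j and 0, so the largest one in absolute value is |w k| = ‖w‖∞.
module Submission where

open import Defs
open import Data.Nat using (ℕ; zero; suc; _≤_; _∸_; z≤n; s≤s)
import Data.Nat.Properties as ℕ
open import Data.Fin using (Fin; punchIn)
import Data.Fin as Fin
open import Data.Fin.Properties using (punchInᵢ≢i; punchIn-injective; punchIn-punchOut)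
open import Data.Integer as ℤ using (ℤ; 0ℤ; ∣_∣)
import Data.Integer.Properties as ℤ
open import Data.Integer.GCD using (gcd)
open import Data.Rational as ℚ using (ℚ; 0ℚ; 1ℚ; _+_; _*_; -_; 1/_; NonZero; ↥_)
import Data.Rational.Properties as ℚ
open import Data.Rational.Solver using (module +-*-Solver)
open +-*-Solver
open import Data.Product using (Σ; ∃; _×_; _,_)
open import Data.Sum using (inj₁; inj₂)
open import Relation.Nullary using (yes; no)
open import Relation.Nullary.Negation using (contradiction)
open import Relation.Binary.PropositionalEquality
  using (_≡_; _≢_; refl; sym; trans; cong; cong₂; subst; module ≡-Reasoning)
open ≡-Reasoning

sumℚ-cong : ∀ n {f g : Fin n → ℚ} → (∀ i → f i ≡ g i) → sumℚ n f ≡ sumℚ n g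
sumℚ-cong zero    f≗g = refl
sumℚ-cong (suc n) f≗g = cong₂ _+_ (f≗g Fin.zero) (sumℚ-cong n (λ i → f≗g (Fin.suc i)))

sumℚ-zero : ∀ n → sumℚ n (λ _ → 0ℚ) ≡ 0ℚ
sumℚ-zero zero    = refl
sumℚ-zero (suc n) = trans (ℚ.+-identityˡ _) (sumℚ-zero n)

sumℚ-*ˡ : ∀ n a (f : Fin n → ℚ) → sumℚ n (λ i → a * f i) ≡ a * sumℚ n f
sumℚ-*ˡ zero    a f = sym (ℚ.*-zeroʳ a)
sumℚ-*ˡ (suc n) a f = trans (cong (a * f Fin.zero +_) (sumℚ-*ˡ n a (λ i → f (Fin.suc i))))
                            (sym (ℚ.*-distribˡ-+ a (f Fin.zero) _))

sumℚ-neg : ∀ n (f : Fin n → ℚ) → sumℚ n (λ i → - f i) ≡ - sumℚ n f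
sumℚ-neg zero    f = refl
sumℚ-neg (suc n) f = trans (cong (- f Fin.zero +_) (sumℚ-neg n (λ i → f (Fin.suc i))))
                           (sym (ℚ.neg-distrib-+ (f Fin.zero) _))

sumℚ-punchIn : ∀ n (k : Fin (suc n)) (f : Fin (suc n) → ℚ) →
               sumℚ (suc n) f ≡ f k + sumℚ n (λ j → f (punchIn k j))
sumℚ-punchIn n       Fin.zero    f = refl
sumℚ-punchIn (suc n) (Fin.suc k) f = begin
  f Fin.zero + sumℚ (suc n) (λ i → f (Fin.suc i))
    ≡⟨ cong (f Fin.zero +_) (sumℚ-punchIn n k (λ i → f (Fin.suc i))) ⟩
  f Fin.zero + (f (Fin.suc k) + s)
    ≡⟨ solve 3 (λ a b t → a :+ (b :+ t) := b :+ (a :+ t)) refl (f Fin.zero) (f (Fin.suc k)) s ⟩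
  f (Fin.suc k) + (f Fin.zero + s) ∎
  where s = sumℚ n (λ j → f (Fin.suc (punchIn k j)))

sumℚ-single : ∀ n (i : Fin n) (f : Fin n → ℚ) → (∀ j → j ≢ i → f j ≡ 0ℚ) → sumℚ n f ≡ f i
sumℚ-single (suc n) i f vanish = begin
  sumℚ (suc n) f                          ≡⟨ sumℚ-punchIn n i f ⟩
  f i + sumℚ n (λ j → f (punchIn i j))    ≡⟨ cong (f i +_) rest≡0 ⟩
  f i + 0ℚ                                ≡⟨ ℚ.+-identityʳ (f i) ⟩
  f i                                     ∎
  where
  rest≡0 : sumℚ n (λ j → f (punchIn i j)) ≡ 0ℚ
  rest≡0 = trans (sumℚ-cong n (λ j → vanish _ (punchInᵢ≢i i j))) (sumℚ-zero n)

maxFin-upper : ∀ n (f : Fin n → ℕ) i → f i ≤ maxFin n f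
maxFin-upper (suc n) f Fin.zero    = ℕ.m≤m⊔n _ _
maxFin-upper (suc n) f (Fin.suc i) = ℕ.≤-trans (maxFin-upper n (λ i → f (Fin.suc i)) i) (ℕ.m≤n⊔m _ _)

maxFin-least : ∀ n (f : Fin n → ℕ) M → (∀ i → f i ≤ M) → maxFin n f ≤ M
maxFin-least zero    f M f≤M = z≤n
maxFin-least (suc n) f M f≤M =
  ℕ.⊔-lub (f≤M Fin.zero) (maxFin-least n (λ i → f (Fin.suc i)) M (λ i → f≤M (Fin.suc i)))

maxFin-attained : ∀ n (f : Fin (suc n) → ℕ) → ∃ λ k → f k ≡ maxFin (suc n) f
maxFin-attained zero    f = Fin.zero , sym (ℕ.⊔-identityʳ (f Fin.zero))
maxFin-attained (suc n) f with maxFin-attained n (λ i → f (Fin.suc i))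
... | k , fk≡max with ℕ.≤-total (f Fin.zero) (maxFin (suc n) (λ i → f (Fin.suc i)))
...   | inj₁ f0≤max = Fin.suc k , trans fk≡max (sym (ℕ.m≤n⇒m⊔n≡n f0≤max))
...   | inj₂ f0≥max = Fin.zero , sym (ℕ.m≥n⇒m⊔n≡m f0≥max)

supNormMat-entry : ∀ m k (H : Fin m → Fin k → ℤ) i j → ∣ H i j ∣ ≤ supNormMat m k H
supNormMat-entry m k H i j =
  ℕ.≤-trans (maxFin-upper k (λ j → ∣ H i j ∣) j) (maxFin-upper m (λ i → maxFin k (λ j → ∣ H i j ∣)) i)

supNormMat-least : ∀ m k (H : Fin m → Fin k → ℤ) B → (∀ i j → ∣ H i j ∣ ≤ B) → supNormMat m k H ≤ B
supNormMat-least m k H B H≤B = maxFin-least m _ B (λ i → maxFin-least k _ B (H≤B i))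

toℚ-neg : ∀ z → toℚ (ℤ.- z) ≡ - toℚ z
toℚ-neg (ℤ.+ zero)    = refl
toℚ-neg ℤ.+[1+ m ]    = refl
toℚ-neg ℤ.-[1+ m ]    = solve 1 (λ q → q := :- (:- q)) refl (toℚ ℤ.+[1+ m ])

-- ↥ (z / 1) * gcd z 1 ≡ z, and the numerator of 0ℚ is 0.
toℚ-nonZero : ∀ z → z ≢ 0ℤ → NonZero (toℚ z)
toℚ-nonZero z z≢0 = ℚ.≢-nonZero {toℚ z} λ z/1≡0 →
  z≢0 (trans (sym (ℚ.↥-/ z 1)) (cong (λ (q : ℚ) → ↥ q ℤ.* gcd z (ℤ.+ 1)) z/1≡0))

data PunchView {n} (k : Fin (suc n)) : Fin (suc n) → Set where
  pivot   : PunchView k k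
  punched : (j : Fin n) → PunchView k (punchIn k j)

punchView : ∀ {n} (k i : Fin (suc n)) → PunchView k i
punchView k i with i Fin.≟ k
... | yes refl = pivot
... | no i≢k   = subst (PunchView k) (punchIn-punchOut (λ k≡i → i≢k (sym k≡i))) (punched _)

-- Column j of H is (w k) e_{p j} − (w (p j)) e_k, where p = punchIn k enumerates the
-- indices other than the pivot k.
module PivotColumns (n : ℕ) (w : Fin (suc n) → ℤ) (k : Fin (suc n)) where

  p : Fin n → Fin (suc n)
  p = punchIn k

  H : Fin (suc n) → Fin n → ℤ
  H i j with i Fin.≟ k
  ... | yes _ = ℤ.- w (p j)
  ... | no _ with i Fin.≟ p j
  ...   | yes _ = w k
  ...   | no _  = 0ℤ

  H-pivot : ∀ j → H k j ≡ ℤ.- w (p j)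
  H-pivot j with k Fin.≟ k
  ... | yes _  = refl
  ... | no k≢k = contradiction refl k≢k

  H-diagonal : ∀ j → H (p j) j ≡ w k
  H-diagonal j with p j Fin.≟ k
  ... | yes pj≡k = contradiction pj≡k (punchInᵢ≢i k j)
  ... | no _ with p j Fin.≟ p j
  ...   | yes _    = refl
  ...   | no pj≢pj = contradiction refl pj≢pj

  H-offDiagonal : ∀ i j → j ≢ i → H (p i) j ≡ 0ℤ
  H-offDiagonal i j j≢i with p i Fin.≟ k
  ... | yes pi≡k = contradiction pi≡k (punchInᵢ≢i k i)
  ... | no _ with p i Fin.≟ p j
  ...   | yes pi≡pj = contradiction (sym (punchIn-injective k i j pi≡pj)) j≢i
  ...   | no _      = refl

  ∣H∣≤ : ∀ B → (∀ i → ∣ w i ∣ ≤ B) → ∀ i j → ∣ H i j ∣ ≤ B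
  ∣H∣≤ B ∣w∣≤B i j with punchView k i
  ... | pivot rewrite H-pivot j | ℤ.∣-i∣≡∣i∣ (w (p j)) = ∣w∣≤B (p j)
  ... | punched i′ with j Fin.≟ i′
  ...   | yes refl rewrite H-diagonal j           = ∣w∣≤B k
  ...   | no j≢i′  rewrite H-offDiagonal i′ j j≢i′ = z≤n

  c : ℚ
  c = toℚ (w k)

  W : Fin n → ℚ
  W j = toℚ (w (p j))

  Hu : (Fin n → ℚ) → Fin (suc n) → ℚ
  Hu = matVecℚ (suc n) n H

  Hu-pivot : ∀ u → Hu u k ≡ - sumℚ n (λ j → W j * u j)
  Hu-pivot u = trans (sumℚ-cong n entry) (sumℚ-neg n (λ j → W j * u j))
    where
    entry : ∀ j → toℚ (H k j) * u j ≡ - (W j * u j)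
    entry j = begin
      toℚ (H k j) * u j        ≡⟨ cong (λ z → toℚ z * u j) (H-pivot j) ⟩
      toℚ (ℤ.- w (p j)) * u j  ≡⟨ cong (_* u j) (toℚ-neg (w (p j))) ⟩
      - W j * u j              ≡⟨ ℚ.neg-distribˡ-* (W j) (u j) ⟨
      - (W j * u j)            ∎

  Hu-punched : ∀ u i → Hu u (p i) ≡ c * u i
  Hu-punched u i = trans (sumℚ-single n i _ offDiagonal) (cong (λ z → toℚ z * u i) (H-diagonal i))
    where
    offDiagonal : ∀ j → j ≢ i → toℚ (H (p i) j) * u j ≡ 0ℚ
    offDiagonal j j≢i = trans (cong (λ z → toℚ z * u j) (H-offDiagonal i j j≢i)) (ℚ.*-zeroˡ (u j))

  dot-pivot : ∀ v → dotℚ (suc n) v w ≡ v k * c + sumℚ n (λ j → v (p j) * W j)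
  dot-pivot v = sumℚ-punchIn n k (λ i → v i * toℚ (w i))

  image⊆⊥ : ∀ v → (∃ λ u → ∀ i → Hu u i ≡ v i) → dotℚ (suc n) v w ≡ 0ℚ
  image⊆⊥ v (u , Hu≡v) = begin
    dotℚ (suc n) v w                                ≡⟨ dot-pivot v ⟩
    v k * c + sumℚ n (λ j → v (p j) * W j)          ≡⟨ cong₂ (λ a b → a * c + b) vk≡ rest≡ ⟩
    - S * c + c * S                                 ≡⟨ solve 2 (λ s a → (:- s) :* a :+ a :* s := con 0ℚ) refl S c ⟩
    0ℚ                                              ∎
    where
    S = sumℚ n (λ j → W j * u j)
    vk≡ : v k ≡ - S
    vk≡ = trans (sym (Hu≡v k)) (Hu-pivot u)
    rest≡ : sumℚ n (λ j → v (p j) * W j) ≡ c * S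
    rest≡ = trans (sumℚ-cong n λ j → trans (cong (_* W j) (trans (sym (Hu≡v (p j))) (Hu-punched u j)))
                                            (solve 3 (λ a b x → (a :* x) :* b := a :* (b :* x)) refl c (W j) (u j)))
                  (sumℚ-*ˡ n c _)

  ⊥⊆image : .{{NonZero c}} → ∀ v → dotℚ (suc n) v w ≡ 0ℚ → ∃ λ u → ∀ i → Hu u i ≡ v i
  ⊥⊆image v v⊥w = u , Hu≡v
    where
    u : Fin n → ℚ
    u j = v (p j) * 1/ c

    T = sumℚ n (λ j → v (p j) * W j)

    T≡ : T ≡ - (v k * c)
    T≡ = begin
      T                             ≡⟨ solve 2 (λ x t → t := (x :+ t) :+ (:- x)) refl (v k * c) T ⟩
      (v k * c + T) + - (v k * c)   ≡⟨ cong (_+ - (v k * c)) (trans (sym (dot-pivot v)) v⊥w) ⟩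
      0ℚ + - (v k * c)              ≡⟨ ℚ.+-identityˡ _ ⟩
      - (v k * c)                   ∎

    cancel : ∀ x → c * (x * 1/ c) ≡ x
    cancel x = begin
      c * (x * 1/ c)    ≡⟨ solve 3 (λ a y b → a :* (y :* b) := y :* (a :* b)) refl c x (1/ c) ⟩
      x * (c * 1/ c)    ≡⟨ cong (x *_) (ℚ.*-inverseʳ c) ⟩
      x * 1ℚ            ≡⟨ ℚ.*-identityʳ x ⟩
      x                 ∎

    Hu≡v : ∀ i → Hu u i ≡ v i
    Hu≡v i with punchView k i
    ... | pivot = begin
      Hu u k                              ≡⟨ Hu-pivot u ⟩
      - sumℚ n (λ j → W j * u j)          ≡⟨ cong -_ (trans (sumℚ-cong n reorder) (sumℚ-*ˡ n (1/ c) _)) ⟩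
      - (1/ c * T)                        ≡⟨ cong (λ t → - (1/ c * t)) T≡ ⟩
      - (1/ c * - (v k * c))              ≡⟨ solve 3 (λ x a b → :- (b :* (:- (x :* a))) := a :* (x :* b)) refl (v k) c (1/ c) ⟩
      c * (v k * 1/ c)                    ≡⟨ cancel (v k) ⟩
      v k                                 ∎
      where
      reorder : ∀ j → W j * u j ≡ 1/ c * (v (p j) * W j)
      reorder j = solve 3 (λ a x b → a :* (x :* b) := b :* (x :* a)) refl (W j) (v (p j)) (1/ c)
    ... | punched j = trans (Hu-punched u j) (cancel (v (p j)))

lemma4p2 : (N : ℕ) → 2 ≤ N → (w : Fin N → ℤ) → (∃ λ i → w i ≢ 0ℤ) →
    Σ (Fin N → Fin (N ∸ 1) → ℤ) λ H →
      ((v : Fin N → ℚ) →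
        ((∃ λ (u : Fin (N ∸ 1) → ℚ) → ∀ i → matVecℚ N (N ∸ 1) H u i ≡ v i) → dotℚ N v w ≡ 0ℚ)
        × (dotℚ N v w ≡ 0ℚ → ∃ λ (u : Fin (N ∸ 1) → ℚ) → ∀ i → matVecℚ N (N ∸ 1) H u i ≡ v i))
      × supNormMat N (N ∸ 1) H ≡ supNormVec N w
lemma4p2 (suc (suc m)) (s≤s (s≤s z≤n)) w (i₀ , wi₀≢0)
  with maxFin-attained (suc m) (λ i → ∣ w i ∣)
... | k , ∣wk∣≡max = H , (λ v → image⊆⊥ v , ⊥⊆image {{c≢0}} v) , trans (ℕ.≤-antisym H≤ H≥) ∣wk∣≡max
  where
  open PivotColumns (suc m) w k
  ∣w∣≤∣wk∣ : ∀ i → ∣ w i ∣ ≤ ∣ w k ∣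
  ∣w∣≤∣wk∣ i = subst (∣ w i ∣ ≤_) (sym ∣wk∣≡max) (maxFin-upper (suc (suc m)) (λ i → ∣ w i ∣) i)
  c≢0 : NonZero c
  c≢0 = toℚ-nonZero (w k) λ wk≡0 →
    wi₀≢0 (ℤ.∣i∣≡0⇒i≡0 (ℕ.n≤0⇒n≡0 (subst (λ z → ∣ w i₀ ∣ ≤ ∣ z ∣) wk≡0 (∣w∣≤∣wk∣ i₀))))
  H≤ : supNormMat (suc (suc m)) (suc m) H ≤ ∣ w k ∣
  H≤ = supNormMat-least _ _ H _ (∣H∣≤ _ ∣w∣≤∣wk∣)
  H≥ : ∣ w k ∣ ≤ supNormMat (suc (suc m)) (suc m) H
  H≥ = subst (λ z → ∣ z ∣ ≤ supNormMat (suc (suc m)) (suc m) H) (H-diagonal Fin.zero) (supNormMat-entry _ _ H (p Fin.zero) Fin.zero)
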